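{- Let $S\subseteq\mathbb T$ be an infinite shape having a finite cut, i.e. there is a finite set $K\subseteq S$ such that $S\setminus K$ has at least two infinite connected components (in the triangular lattice $\mathbb T$). Then for every scaling scheme $\Lambda$ and every oritatami system $\mathcal O$, the shape $\Lambda(S)$ is not foldable in $\mathcal O$, i.e. $\Lambda(S)$ is not the shape of the result of any foldable sequence of $\mathcal O$ starting from its seed.
   Context: Triangular lattice: $\mathbb T=(\mathbb Z^2,\sim)$ with $(x,y)\sim(u,v)$ iff $(u,v)-(x,y)\in\{\pm(1,0),\pm(0,1),\pm(1,1)\}$. A shape is a connected set of points of $\mathbb T$. Oritatami system (OS) $\mathcal O=(B,w,\heartsuit,\delta,\alpha)$: a finite set $B$ of bead types, a finite or infinite transcript $w$ over $B$, a symmetric attraction rule $\heartsuit\subseteq B^2$, a delay $\delta\ge1$ and an arity $\alpha$, together with a seed configuration $\sigma$ of a prefix of $w$. A routing of $w$ is a self-avoiding path $r_0,r_1,\dots$ in $\mathbb T$ whose $i$-th vertex is labelled $w_i$. A configuration $c=(r,H)$ is a routing of a prefix of $w$ together with a set $H$ of bonds, each bond being a pair $r_ir_j$ of adjacent positions with $|i-j|>1$ and $w_i\heartsuit w_j$; it is valid if each position is in at most $\alpha$ bonds. $h(c)=|H|$. A $k$-elongation of $c$ is a valid configuration extending the path by $k$ positions and whose bond set contains $H$. The dynamics maps a set $S$ of configurations to $\mathscr D(S)=\bigcup_{c\in S}\arg\max_{\gamma}\max_{\eta} h(\eta)$, where $\gamma$ ranges over 1-elongations of $c$ and $\eta$ over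 $\min(\delta-1,|w|-|\gamma|)$-elongations of $\gamma$. A foldable sequence is $\sigma=c^0,c^1,\dots$ with $c^{t+1}\in\mathscr D(\{c^t\})$; its result is its last configuration if it halts (no further elongation possible) or the union (limit) of its configurations if infinite. The shape of a configuration is the set of points covered by its routing. A scaling scheme $\Lambda=(\lambda,\mu)$ consists of a homothetic linear map $\lambda:\mathbb T\to\mathbb T$ and a shape $\mu\ni(0,0)$ (the cell mold); the cell of $p$ is $\Lambda(p)=\lambda(p)+\mu$ and $\Lambda(S)=\bigcup_{p\in S}\Lambda(p)$; scaling schemes are required to satisfy: cells $\Lambda(p),\Lambda(q)$ intersect or contain adjacent points iff $p\sim q$. -}

module Defs where

open import Data.Nat using (ℕ; suc; _≤_; _<_; _∸_; _⊓_; _≡ᵇ_)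
open import Data.Nat using () renaming (_+_ to _+ℕ_)
open import Data.Integer using (ℤ; _+_; _*_; +_; -_; 0ℤ; 1ℤ)
open import Data.Fin using (Fin)
open import Data.Bool using (Bool; true; _∨_)
open import Data.Maybe using (Maybe; just; nothing)
open import Data.Unit using (⊤)
open import Data.Product using (Σ; _×_; _,_; proj₁; proj₂)
open import Data.Sum using (_⊎_)
open import Data.List using (List; length; filterᵇ)
open import Data.List.Membership.Propositional using (_∈_)
open import Data.List.Relation.Unary.All using (All)
open import Data.List.Relation.Unary.Unique.Propositional using (Unique)
open import Relation.Nullary using (¬_)
open import Relation.Binary.PropositionalEquality using (_≡_; _≢_)

Pt : Set
Pt = ℤ × ℤ

_⊕_ : Pt → Pt → Pt
(a , b) ⊕ (c , d) = (a + c , b + d)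

data Dir : Set where
  dE dW dN dS dNE dSW : Dir

vec : Dir → Pt
vec dE  = (1ℤ , 0ℤ)
vec dW  = (- 1ℤ , 0ℤ)
vec dN  = (0ℤ , 1ℤ)
vec dS  = (0ℤ , - 1ℤ)
vec dNE = (1ℤ , 1ℤ)
vec dSW = (- 1ℤ , - 1ℤ)

Adj : Pt → Pt → Set
Adj p q = Σ Dir λ d → q ≡ p ⊕ vec d

PtSet : Set₁
PtSet = Pt → Set

data Path (T : PtSet) : Pt → Pt → Set where
  here : ∀ {p} → T p → Path T p p
  step : ∀ {p r q} → T p → Adj p r → Path T r q → Path T p q

Connected : PtSet → Set
Connected T = ∀ p q → T p → T q → Path T p q

FiniteSet : PtSet → Set
FiniteSet T = Σ (List Pt) λ L → ∀ p → T p → p ∈ L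

Infinite : PtSet → Set
Infinite T = ¬ FiniteSet T

_∖_ : PtSet → List Pt → PtSet
(S ∖ K) p = S p × ¬ (p ∈ K)

Component : PtSet → Pt → PtSet
Component T p x = Path T p x

HasFiniteCut : PtSet → Set
HasFiniteCut S =
  Σ (List Pt) λ K → (∀ p → p ∈ K → S p) ×
  (Σ Pt λ p → Σ Pt λ q → (S ∖ K) p × (S ∖ K) q × ¬ Path (S ∖ K) p q
     × Infinite (Component (S ∖ K) p) × Infinite (Component (S ∖ K) q))

scalePt : ℤ → Pt → Pt
scalePt k (a , b) = (k * a , k * b)

CellOf : ℤ → PtSet → Pt → PtSet
CellOf k μ p x = Σ Pt λ m → μ m × x ≡ scalePt k p ⊕ m

CellsTouch : ℤ → PtSet → Pt → Pt → Set
CellsTouch k μ p q =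
  (Σ Pt λ x → CellOf k μ p x × CellOf k μ q x) ⊎
  (Σ Pt λ x → Σ Pt λ y → CellOf k μ p x × CellOf k μ q y × Adj x y)

record ScalingScheme : Set₁ where
  field
    k           : ℤ
    μ           : PtSet
    μ-shape     : Connected μ
    μ-origin    : μ (0ℤ , 0ℤ)
    separation  : ∀ p q → p ≢ q →
                  (CellsTouch k μ p q → Adj p q) × (Adj p q → CellsTouch k μ p q)

Cell : ScalingScheme → Pt → PtSet
Cell Λ = CellOf (ScalingScheme.k Λ) (ScalingScheme.μ Λ)

ScaleSet : ScalingScheme → PtSet → PtSet
ScaleSet Λ S x = Σ Pt λ p → S p × Cell Λ p x

-- the data (B, w, ♥, δ, α); B = Fin nB; transcript length
-- wlen = just n (finite, length n) or nothing (infinite)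
record OSData : Set where
  field
    nB     : ℕ
    w      : ℕ → Fin nB
    wlen   : Maybe ℕ
    att    : Fin nB → Fin nB → Bool
    att-sym : ∀ a b → att a b ≡ att b a
    δ      : ℕ
    δ≥1    : 1 ≤ δ
    α      : ℕ

-- a configuration: routing r_0 … r_{len-1} (values of pos beyond len
-- are irrelevant) and a list of bonds (i , j) with i < j
record Config : Set where
  constructor conf
  field
    len   : ℕ
    pos   : ℕ → Pt
    bonds : List (ℕ × ℕ)

open Config public

InPrefix : Maybe ℕ → ℕ → Set
InPrefix nothing  m = ⊤
InPrefix (just n) m = m ≤ n

involves : ℕ → ℕ × ℕ → Bool
involves i (a , b) = (i ≡ᵇ a) ∨ (i ≡ᵇ b)

degree : ℕ → Config → ℕ
degree i c = length (filterᵇ (involves i) (bonds c))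

h : Config → ℕ
h c = length (bonds c)

ValidConfig : OSData → Config → Set
ValidConfig O c =
  InPrefix wlen (len c) ×
  (∀ i → suc i < len c → Adj (pos c i) (pos c (suc i))) ×
  (∀ i j → i < len c → j < len c → pos c i ≡ pos c j → i ≡ j) ×
  Unique (bonds c) ×
  All (λ b → suc (proj₁ b) < proj₂ b × proj₂ b < len c
             × Adj (pos c (proj₁ b)) (pos c (proj₂ b))
             × att (w (proj₁ b)) (w (proj₂ b)) ≡ true) (bonds c) ×
  (∀ i → degree i c ≤ α)
  where open OSData O

Elong : OSData → ℕ → Config → Config → Set
Elong O k c c' =
  ValidConfig O c' × len c' ≡ len c +ℕ k ×
  (∀ i → i < len c → pos c' i ≡ pos c i) ×
  (∀ b → b ∈ bonds c → b ∈ bonds c')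

delayLen : OSData → ℕ → ℕ
delayLen O m with OSData.wlen O
... | nothing = OSData.δ O ∸ 1
... | just n  = (OSData.δ O ∸ 1) ⊓ (n ∸ m)

Step : OSData → Config → Config → Set
Step O c γ =
  Elong O 1 c γ ×
  (Σ Config λ η → Elong O (delayLen O (len γ)) γ η ×
     (∀ γ' η' → Elong O 1 c γ' → Elong O (delayLen O (len γ')) γ' η' → h η' ≤ h η))

record OS : Set where
  field
    dat        : OSData
    seed       : Config
    seed-valid : ValidConfig dat seed

Covered : Config → PtSet
Covered c x = Σ ℕ λ i → i < len c × pos c i ≡ x

FoldsFinite : OS → PtSet → Set
FoldsFinite O X =
  Σ ℕ λ T → Σ (ℕ → Config) λ c →
    c 0 ≡ OS.seed O ×
    (∀ t → t < T → Step (OS.dat O) (c t) (c (suc t))) ×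
    ¬ (Σ Config λ γ → Elong (OS.dat O) 1 (c T) γ) ×
    (∀ x → (X x → Covered (c T) x) × (Covered (c T) x → X x))

FoldsInfinite : OS → PtSet → Set
FoldsInfinite O X =
  Σ (ℕ → Config) λ c →
    c 0 ≡ OS.seed O ×
    (∀ t → Step (OS.dat O) (c t) (c (suc t))) ×
    (∀ x → (X x → Σ ℕ λ t → Covered (c t) x) × (Σ ℕ (λ t → Covered (c t) x) → X x))

Foldable : OS → PtSet → Set
Foldable O X = FoldsFinite O X ⊎ FoldsInfinite O X

-- A halting fold has a finite shape, and Λ(S) finite forces S finite because s ↦ k·s is
-- injective. In an infinite fold every cell is finite (its points are told apart by their
-- residues modulo 2k) and the routing is injective, so it eventually leaves Λ(K) for good.
-- From then on the cells it visits have origins forming a walk in S ∖ K, and every point of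
-- S ∖ K off that walk's component is the origin of a cell visited earlier. Hence one of the
-- two infinite components of S ∖ K would be finite.
module Submission where

open import Defs
open import Data.Empty using (⊥-elim)
open import Data.Integer as ℤ
  using (ℤ; +_; 0ℤ; -_; _+_; _*_; _-_; _/_; _%_; ∣_∣; NonZero; ≢-nonZero)
open import Data.Integer.DivMod using (a≡a%n+[a/n]*n; n%d<d)
open import Data.Integer.Properties
  using (+-identityʳ; *-zeroʳ; abs-*; i*j≡0⇒i≡0∨j≡0; i*j≢0; ∣i∣≡0⇒i≡0; i-j≡0⇒i≡j)
open import Data.Integer.Tactic.RingSolver using (solve-∀)
open import Data.List using (List; []; _∷_; map; upTo; cartesianProduct)
open import Data.List.Membership.Propositional using (_∈_)
open import Data.List.Membership.Propositional.Properties
  using (∈-map⁺; ∈-upTo⁺; ∈-cartesianProduct⁺)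
open import Data.List.Relation.Unary.Any using (here; there)
open import Data.List.Relation.Unary.Any.Properties using (¬Any[])
open import Data.Nat as ℕ using (ℕ; zero; suc; _≤_; _<_; _<?_; _∸_)
import Data.Nat.Properties as ℕₚ
open import Data.Product using (Σ; _×_; _,_; proj₁; proj₂)
open import Data.Product.Properties using (≡-dec; ,-injective)
open import Data.Sum using (_⊎_; inj₁; inj₂)
open import Effect.Monad using (RawMonad)
open import Function using (_∘_; case_of_)
open import Level using (0ℓ)
open import Relation.Nullary using (¬_; Dec; yes; no; contradiction)
open import Relation.Nullary.Decidable using (¬¬-excluded-middle)
open import Relation.Nullary.Negation using (¬¬-Monad)
open import Relation.Binary.PropositionalEquality
open ≡-Reasoning

Near : Pt → Pt → Set
Near p q = p ≡ q ⊎ Adj p q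

_≟ₚ_ : (p q : Pt) → Dec (p ≡ q)
_≟ₚ_ = ≡-dec ℤ._≟_ ℤ._≟_

negate : Pt → Pt
negate (a , b) = (- a , - b)

opposite : Dir → Dir
opposite dE  = dW
opposite dW  = dE
opposite dN  = dS
opposite dS  = dN
opposite dNE = dSW
opposite dSW = dNE

vec-opposite : ∀ d → vec (opposite d) ≡ negate (vec d)
vec-opposite dE  = refl
vec-opposite dW  = refl
vec-opposite dN  = refl
vec-opposite dS  = refl
vec-opposite dNE = refl
vec-opposite dSW = refl

⊕-identityʳ : ∀ p → p ⊕ (0ℤ , 0ℤ) ≡ p
⊕-identityʳ (a , b) = cong₂ _,_ (+-identityʳ a) (+-identityʳ b)

⊕-negate-cancelʳ : ∀ p u → (p ⊕ u) ⊕ negate u ≡ p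
⊕-negate-cancelʳ (a , b) (x , y) = cong₂ _,_ (cancel a x) (cancel b y)
  where
  cancel : ∀ a x → (a + x) + - x ≡ a
  cancel = solve-∀

⊕-cancelˡ : ∀ p {u v} → p ⊕ u ≡ p ⊕ v → u ≡ v
⊕-cancelˡ p {u} {v} e = begin
  u                    ≡⟨ cancel p u ⟨
  negate p ⊕ (p ⊕ u)   ≡⟨ cong (negate p ⊕_) e ⟩
  negate p ⊕ (p ⊕ v)   ≡⟨ cancel p v ⟩
  v                    ∎
  where
  cancel-ℤ : ∀ a x → - a + (a + x) ≡ x
  cancel-ℤ = solve-∀
  cancel : ∀ p u → negate p ⊕ (p ⊕ u) ≡ u
  cancel (a , b) (x , y) = cong₂ _,_ (cancel-ℤ a x) (cancel-ℤ b y)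

adj-sym : ∀ {p q} → Adj p q → Adj q p
adj-sym {p} (d , refl) = opposite d , (begin
  p                                  ≡⟨ ⊕-negate-cancelʳ p (vec d) ⟨
  (p ⊕ vec d) ⊕ negate (vec d)       ≡⟨ cong ((p ⊕ vec d) ⊕_) (vec-opposite d) ⟨
  (p ⊕ vec d) ⊕ vec (opposite d)     ∎)

∣2*i∣≢1 : ∀ i → ∣ + 2 * i ∣ ≢ 1
∣2*i∣≢1 i e with ℕₚ.m*n≡1⇒m≡1 2 ∣ i ∣ (trans (sym (abs-* (+ 2) i)) e)
... | ()

double≢vec : ∀ t d → scalePt (+ 2) t ≢ vec d
double≢vec (x , y) dE  e = ∣2*i∣≢1 x (cong (∣_∣ ∘ proj₁) e)
double≢vec (x , y) dW  e = ∣2*i∣≢1 x (cong (∣_∣ ∘ proj₁) e)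
double≢vec (x , y) dN  e = ∣2*i∣≢1 y (cong (∣_∣ ∘ proj₂) e)
double≢vec (x , y) dS  e = ∣2*i∣≢1 y (cong (∣_∣ ∘ proj₂) e)
double≢vec (x , y) dNE e = ∣2*i∣≢1 x (cong (∣_∣ ∘ proj₁) e)
double≢vec (x , y) dSW e = ∣2*i∣≢1 x (cong (∣_∣ ∘ proj₁) e)

near-double⇒zero : ∀ p t → Near p (p ⊕ scalePt (+ 2) t) → t ≡ (0ℤ , 0ℤ)
near-double⇒zero p t (inj₁ p≡p+2t) = cong₂ _,_ (halve (cong proj₁ 0≡2t)) (halve (cong proj₂ 0≡2t))
  where
  0≡2t : (0ℤ , 0ℤ) ≡ scalePt (+ 2) t
  0≡2t = ⊕-cancelˡ p (trans (⊕-identityʳ p) p≡p+2t)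
  halve : ∀ {i} → 0ℤ ≡ + 2 * i → i ≡ 0ℤ
  halve e with i*j≡0⇒i≡0∨j≡0 (+ 2) (sym e)
  ... | inj₁ ()
  ... | inj₂ i≡0 = i≡0
near-double⇒zero p t (inj₂ (d , e)) = ⊥-elim (double≢vec t d (⊕-cancelˡ p e))

path-end : ∀ {T p q} → Path T p q → T q
path-end (here q∈T)      = q∈T
path-end (step _ _ path) = path-end path

path-snoc : ∀ {T p q r} → Path T p q → T r → Adj q r → Path T p r
path-snoc (here q∈T)          r∈T q∼r = step q∈T q∼r (here r∈T)
path-snoc (step p∈T p∼s path) r∈T q∼r = step p∈T p∼s (path-snoc path r∈T q∼r)

path-extend : ∀ {T p q r} → Path T p q → T r → Near q r → Path T p r
path-extend path _   (inj₁ refl) = path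
path-extend path r∈T (inj₂ q∼r)  = path-snoc path r∈T q∼r

path-sym : ∀ {T p q} → Path T p q → Path T q p
path-sym (here p∈T)          = here p∈T
path-sym (step p∈T p∼s path) = path-snoc (path-sym path) p∈T (adj-sym p∼s)

path-trans : ∀ {T p q r} → Path T p q → Path T q r → Path T p r
path-trans (here _)            path′ = path′
path-trans (step p∈T p∼s path) path′ = step p∈T p∼s (path-trans path path′)

module _ where
  open RawMonad (¬¬-Monad {0ℓ})

  ¬¬-eventually-absent :
    {A : Set} (L : List A) (Q : ℕ → Set) (label : ∀ {i} → Q i → A) →
    (∀ {i} (q : Q i) → label q ∈ L) →
    (∀ {i j} (qᵢ : Q i) (qⱼ : Q j) → label qᵢ ≡ label qⱼ → i ≡ j) →
    ¬ ¬ (Σ ℕ λ N → ∀ i → N ≤ i → ¬ Q i)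
  ¬¬-eventually-absent [] Q label label∈ _ =
    pure (0 , λ i _ q → ¬Any[] (label∈ q))
  ¬¬-eventually-absent (a ∷ L) Q label label∈ label-injective = do
    (N , absent) ← ¬¬-eventually-absent L Q′ (label ∘ proj₁) proj₂
                     (λ qᵢ qⱼ → label-injective (proj₁ qᵢ) (proj₁ qⱼ))
    hit? ← ¬¬-excluded-middle
    pure (bound N absent hit?)
    where
    Q′ : ℕ → Set
    Q′ i = Σ (Q i) λ q → label q ∈ L
    Hit : Set
    Hit = Σ ℕ λ i → Σ (Q i) λ q → label q ≡ a
    split : ∀ {i} (q : Q i) → label q ≡ a ⊎ Q′ i
    split q with label∈ q
    ... | here label≡a = inj₁ label≡a
    ... | there label∈L = inj₂ (q , label∈L)
    bound : (N : ℕ) → (∀ i → N ≤ i → ¬ Q′ i) → Dec Hit → Σ ℕ λ M → ∀ i → M ≤ i → ¬ Q i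
    bound N absent (yes (i₀ , q₀ , e₀)) = N ℕ.+ suc i₀ , λ i M≤i q → case split q of λ where
      (inj₁ e) → ℕₚ.<⇒≢ (ℕₚ.m+n≤o⇒n≤o N M≤i) (sym (label-injective q q₀ (trans e (sym e₀))))
      (inj₂ q′) → absent i (ℕₚ.m+n≤o⇒m≤o N M≤i) q′
    bound N absent (no miss) = N , λ i N≤i q → case split q of λ where
      (inj₁ e) → miss (i , q , e)
      (inj₂ q′) → absent i N≤i q′

m*n<n⇒m≡0 : ∀ m {n} → m ℕ.* n < n → m ≡ 0
m*n<n⇒m≡0 zero    _       = refl
m*n<n⇒m≡0 (suc m) {n} lt = contradiction (ℕₚ.m≤m+n n (m ℕ.* n)) (ℕₚ.<⇒≱ lt)

*-/-cancelˡ : ∀ i j .{{_ : NonZero i}} → (i * j) / i ≡ j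
*-/-cancelˡ i j = sym (i-j≡0⇒i≡j j q (∣i∣≡0⇒i≡0 (m*n<n⇒m≡0 ∣ j - q ∣ ∣j-q∣*∣i∣<∣i∣)))
  where
  q : ℤ
  q = (i * j) / i
  r : ℕ
  r = (i * j) % i
  rearrange : ∀ r x → r ≡ (r + x) - x
  rearrange = solve-∀
  factor : ∀ i j q → i * j - q * i ≡ (j - q) * i
  factor = solve-∀
  r≡[j-q]*i : + r ≡ (j - q) * i
  r≡[j-q]*i = begin
    + r                  ≡⟨ rearrange (+ r) (q * i) ⟩
    (+ r + q * i) - q * i ≡⟨ cong (_- q * i) (a≡a%n+[a/n]*n (i * j) i) ⟨
    i * j - q * i        ≡⟨ factor i j q ⟩
    (j - q) * i          ∎
  ∣j-q∣*∣i∣<∣i∣ : ∣ j - q ∣ ℕ.* ∣ i ∣ < ∣ i ∣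
  ∣j-q∣*∣i∣<∣i∣ = subst (_< ∣ i ∣) (trans (cong ∣_∣ r≡[j-q]*i) (abs-* (j - q) i)) (n%d<d (i * j) i)

%≡%⇒≡+* : ∀ a b n .{{_ : NonZero n}} → a % n ≡ b % n → a ≡ b + n * (a / n - b / n)
%≡%⇒≡+* a b n same = begin
  a                                    ≡⟨ a≡a%n+[a/n]*n a n ⟩
  + (a % n) + a / n * n                ≡⟨ cong (λ r → + r + a / n * n) same ⟩
  + (b % n) + a / n * n                ≡⟨ shift (+ (b % n)) (a / n) (b / n) n ⟩
  (+ (b % n) + b / n * n) + n * (a / n - b / n) ≡⟨ cong (_+ n * (a / n - b / n)) (a≡a%n+[a/n]*n b n) ⟨
  b + n * (a / n - b / n)              ∎
  where
  shift : ∀ r x y n → r + x * n ≡ (r + y * n) + n * (x - y)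
  shift = solve-∀

module Scaling (Λ : ScalingScheme) where
  open ScalingScheme Λ

  touching⇒near : ∀ {p q} → CellsTouch k μ p q → Near p q
  touching⇒near {p} {q} touch with p ≟ₚ q
  ... | yes p≡q = inj₁ p≡q
  ... | no  p≢q = inj₂ (proj₁ (separation p q p≢q) touch)

  cells-meet⇒near : ∀ {p q x} → Cell Λ p x → Cell Λ q x → Near p q
  cells-meet⇒near {x = x} x∈p x∈q = touching⇒near (inj₁ (x , x∈p , x∈q))

  cells-adjacent⇒near : ∀ {p q x y} → Cell Λ p x → Cell Λ q y → Adj x y → Near p q
  cells-adjacent⇒near {x = x} {y} x∈p y∈q x∼y = touching⇒near (inj₂ (x , y , x∈p , y∈q , x∼y))

  centre : Pt → Pt
  centre p = scalePt k p ⊕ (0ℤ , 0ℤ)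

  centre∈cell : ∀ p → Cell Λ p (centre p)
  centre∈cell p = (0ℤ , 0ℤ) , μ-origin , refl

  centre∈ScaleSet : ∀ {S s} → S s → ScaleSet Λ S (centre s)
  centre∈ScaleSet {s = s} s∈S = s , s∈S , centre∈cell s

  k≢0 : k ≢ 0ℤ
  k≢0 k≡0 = not-near (cells-meet⇒near (origin∈cell (0ℤ , 0ℤ)) (origin∈cell (+ 2 , 0ℤ)))
    where
    origin∈cell : ∀ p → Cell Λ p (0ℤ , 0ℤ)
    origin∈cell p = (0ℤ , 0ℤ) , μ-origin , cong (λ z → scalePt z p ⊕ (0ℤ , 0ℤ)) (sym k≡0)
    not-near : ¬ Near (0ℤ , 0ℤ) (+ 2 , 0ℤ)
    not-near (inj₁ ())
    not-near (inj₂ (dE  , ()))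
    not-near (inj₂ (dW  , ()))
    not-near (inj₂ (dN  , ()))
    not-near (inj₂ (dS  , ()))
    not-near (inj₂ (dNE , ()))
    not-near (inj₂ (dSW , ()))

  instance
    k-nonZero : NonZero k
    k-nonZero = ≢-nonZero k≢0

  unscale : Pt → Pt
  unscale (a , b) = (a / k , b / k)

  unscale-centre : ∀ p → unscale (centre p) ≡ p
  unscale-centre (a , b) = cong₂ _,_ (unscale-coord a) (unscale-coord b)
    where
    unscale-coord : ∀ a → (k * a + 0ℤ) / k ≡ a
    unscale-coord a = trans (cong (_/ k) (+-identityʳ (k * a))) (*-/-cancelˡ k a)

  ScaleSet-finite⇒finite : ∀ {S} → FiniteSet (ScaleSet Λ S) → FiniteSet S
  ScaleSet-finite⇒finite (L , cover) = map unscale L , λ s s∈S →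
    subst (_∈ map unscale L) (unscale-centre s) (∈-map⁺ unscale (cover _ (centre∈ScaleSet s∈S)))

  modulus : ℤ
  modulus = + 2 * k

  instance
    modulus-nonZero : NonZero modulus
    modulus-nonZero = i*j≢0 (+ 2) k

  residue : Pt → ℕ × ℕ
  residue (a , b) = (a % modulus , b % modulus)

  cell-shift : ∀ {κ y} t → Cell Λ κ y → Cell Λ (κ ⊕ scalePt (+ 2) t) (y ⊕ scalePt modulus t)
  cell-shift {a , b} (x , y) (m , m∈μ , refl) = m , m∈μ , cong₂ _,_ (shift k a (proj₁ m) x) (shift k b (proj₂ m) y)
    where
    shift : ∀ k a m t → (k * a + m) + (+ 2 * k) * t ≡ k * (a + + 2 * t) + m
    shift = solve-∀

  -- Two points of one cell differing by 2k·t lie in the cells of κ and κ + 2t,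
  -- which then share a point; parity rules out adjacency, so t = 0.
  residue-injective-on-cell : ∀ {κ y y′} → Cell Λ κ y → Cell Λ κ y′ → residue y ≡ residue y′ → y ≡ y′
  residue-injective-on-cell {κ} {y@(a , b)} {y′@(a′ , b′)} y∈κ y′∈κ same = begin
    y                                ≡⟨ y≡y′+2kt ⟩
    y′ ⊕ scalePt modulus t           ≡⟨ cong (λ u → y′ ⊕ scalePt modulus u) t≡0 ⟩
    y′ ⊕ scalePt modulus (0ℤ , 0ℤ)   ≡⟨ cong (y′ ⊕_) (cong₂ _,_ (*-zeroʳ modulus) (*-zeroʳ modulus)) ⟩
    y′ ⊕ (0ℤ , 0ℤ)                   ≡⟨ ⊕-identityʳ y′ ⟩
    y′                               ∎
    where
    t : Pt
    t = (a / modulus - a′ / modulus , b / modulus - b′ / modulus)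
    y≡y′+2kt : y ≡ y′ ⊕ scalePt modulus t
    y≡y′+2kt = cong₂ _,_ (%≡%⇒≡+* a a′ modulus (cong proj₁ same)) (%≡%⇒≡+* b b′ modulus (cong proj₂ same))
    t≡0 : t ≡ (0ℤ , 0ℤ)
    t≡0 = near-double⇒zero κ t
            (cells-meet⇒near y∈κ (subst (Cell Λ (κ ⊕ scalePt (+ 2) t)) (sym y≡y′+2kt) (cell-shift t y′∈κ)))

halting-fold-finite : ∀ {O X} → FoldsFinite O X → FiniteSet X
halting-fold-finite (T , c , _ , _ , _ , shape) =
  map (pos (c T)) (upTo (len (c T))) , λ x x∈X →
    let (i , i<len , rᵢ≡x) = proj₁ (shape x) x∈X
    in subst (_∈ _) rᵢ≡x (∈-map⁺ (pos (c T)) (∈-upTo⁺ i<len))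

module Routing {D : OSData} {c : ℕ → Config} (steps : ∀ t → Step D (c t) (c (suc t))) where

  elongation : ∀ t → Elong D 1 (c t) (c (suc t))
  elongation t = proj₁ (steps t)

  len-c : ∀ t → len (c t) ≡ len (c 0) ℕ.+ t
  len-c zero    = sym (ℕₚ.+-identityʳ _)
  len-c (suc t) = begin
    len (c (suc t))           ≡⟨ proj₁ (proj₂ (elongation t)) ⟩
    len (c t) ℕ.+ 1           ≡⟨ cong (ℕ._+ 1) (len-c t) ⟩
    len (c 0) ℕ.+ t ℕ.+ 1     ≡⟨ ℕₚ.+-assoc (len (c 0)) t 1 ⟩
    len (c 0) ℕ.+ (t ℕ.+ 1)   ≡⟨ cong (len (c 0) ℕ.+_) (ℕₚ.+-comm t 1) ⟩
    len (c 0) ℕ.+ suc t       ∎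

  <⇒<len : ∀ {i t} → i < t → i < len (c t)
  <⇒<len {i} {t} i<t = subst (i <_) (sym (len-c t)) (ℕₚ.<-≤-trans i<t (ℕₚ.m≤n+m t _))

  len-mono : ∀ t n → len (c t) ≤ len (c (n ℕ.+ t))
  len-mono t n = subst₂ _≤_ (sym (len-c t)) (sym (len-c (n ℕ.+ t)))
                   (ℕₚ.+-monoʳ-≤ (len (c 0)) (ℕₚ.m≤n+m t n))

  pos-stable : ∀ t n {i} → i < len (c t) → pos (c (n ℕ.+ t)) i ≡ pos (c t) i
  pos-stable t zero    _     = refl
  pos-stable t (suc n) i<len =
    trans (proj₁ (proj₂ (proj₂ (elongation (n ℕ.+ t)))) _ (ℕₚ.<-≤-trans i<len (len-mono t n)))
          (pos-stable t n i<len)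

  routing : ℕ → Pt
  routing i = pos (c (suc i)) i

  pos≡routing : ∀ t {i} → i < len (c t) → pos (c t) i ≡ routing i
  pos≡routing t {i} i<len = begin
    pos (c t) i                ≡⟨ pos-stable t (suc i) i<len ⟨
    pos (c (suc i ℕ.+ t)) i    ≡⟨ cong (λ u → pos (c u) i) (ℕₚ.+-comm (suc i) t) ⟩
    pos (c (t ℕ.+ suc i)) i    ≡⟨ pos-stable (suc i) t (<⇒<len (ℕₚ.n<1+n i)) ⟩
    routing i                  ∎

  routing-adjacent : ∀ i → Adj (routing i) (routing (suc i))
  routing-adjacent i =
    subst₂ Adj (pos≡routing (suc (suc i)) i<len) (pos≡routing (suc (suc i)) (<⇒<len (ℕₚ.n<1+n (suc i))))
      (adjacent i (<⇒<len (ℕₚ.n<1+n (suc i))))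
    where
    adjacent : ∀ j → suc j < len (c (suc (suc i))) → Adj (pos (c (suc (suc i))) j) (pos (c (suc (suc i))) (suc j))
    adjacent = proj₁ (proj₂ (proj₁ (elongation (suc i))))
    i<len : i < len (c (suc (suc i)))
    i<len = <⇒<len (ℕₚ.m<n⇒m<1+n (ℕₚ.n<1+n i))

  routing-injective : ∀ i j → routing i ≡ routing j → i ≡ j
  routing-injective i j rᵢ≡rⱼ =
    self-avoiding i j i<len j<len (trans (pos≡routing _ i<len) (trans rᵢ≡rⱼ (sym (pos≡routing _ j<len))))
    where
    self-avoiding : ∀ m n → m < len (c (suc (i ℕ.+ j))) → n < len (c (suc (i ℕ.+ j))) →
                    pos (c (suc (i ℕ.+ j))) m ≡ pos (c (suc (i ℕ.+ j))) n → m ≡ n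
    self-avoiding = proj₁ (proj₂ (proj₂ (proj₁ (elongation (i ℕ.+ j)))))
    i<len : i < len (c (suc (i ℕ.+ j)))
    i<len = <⇒<len (ℕ.s≤s (ℕₚ.m≤m+n i j))
    j<len : j < len (c (suc (i ℕ.+ j)))
    j<len = <⇒<len (ℕ.s≤s (ℕₚ.m≤n+m j i))

module InfiniteFold {S : PtSet} {Λ : ScalingScheme} {D : OSData} {c : ℕ → Config}
  (steps : ∀ t → Step D (c t) (c (suc t)))
  (shape : ∀ x → (ScaleSet Λ S x → Σ ℕ λ t → Covered (c t) x) × (Σ ℕ (λ t → Covered (c t) x) → ScaleSet Λ S x))
  where
  open Scaling Λ
  open Routing steps

  routing∈ScaleSet : ∀ i → ScaleSet Λ S (routing i)
  routing∈ScaleSet i = proj₂ (shape (routing i)) (suc i , i , <⇒<len (ℕₚ.n<1+n i) , refl)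

  ScaleSet⇒routing : ∀ {x} → ScaleSet Λ S x → Σ ℕ λ i → routing i ≡ x
  ScaleSet⇒routing {x} x∈ΛS =
    let (t , i , i<len , pos≡x) = proj₁ (shape x) x∈ΛS
    in i , trans (sym (pos≡routing t i<len)) pos≡x

  origin : ℕ → Pt
  origin i = proj₁ (routing∈ScaleSet i)

  origin∈S : ∀ i → S (origin i)
  origin∈S i = proj₁ (proj₂ (routing∈ScaleSet i))

  routing∈cell : ∀ i → Cell Λ (origin i) (routing i)
  routing∈cell i = proj₂ (proj₂ (routing∈ScaleSet i))

  origin-near : ∀ i → Near (origin i) (origin (suc i))
  origin-near i = cells-adjacent⇒near (routing∈cell i) (routing∈cell (suc i)) (routing-adjacent i)

  ¬¬-eventually-leaves : (K : List Pt) → ¬ ¬ (Σ ℕ λ N → ∀ i → N ≤ i → ¬ ScaleSet Λ (_∈ K) (routing i))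
  ¬¬-eventually-leaves K = ¬¬-eventually-absent labels (ScaleSet Λ (_∈ K) ∘ routing) label label∈ label-injective
    where
    n : ℕ
    n = ∣ modulus ∣
    labels : List (Pt × (ℕ × ℕ))
    labels = cartesianProduct K (cartesianProduct (upTo n) (upTo n))
    label : ∀ {i} → ScaleSet Λ (_∈ K) (routing i) → Pt × (ℕ × ℕ)
    label {i} (κ , _) = κ , residue (routing i)
    label∈ : ∀ {i} (q : ScaleSet Λ (_∈ K) (routing i)) → label q ∈ labels
    label∈ {i} (κ , κ∈K , _) =
      ∈-cartesianProduct⁺ κ∈K (∈-cartesianProduct⁺ (∈-upTo⁺ (n%d<d (proj₁ (routing i)) modulus))
                                                    (∈-upTo⁺ (n%d<d (proj₂ (routing i)) modulus)))
    label-injective : ∀ {i j} (qᵢ : ScaleSet Λ (_∈ K) (routing i)) (qⱼ : ScaleSet Λ (_∈ K) (routing j)) →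
                      label qᵢ ≡ label qⱼ → i ≡ j
    label-injective {i} {j} (κ , _ , rᵢ∈κ) (κ′ , _ , rⱼ∈κ′) same with ,-injective same
    ... | refl , same-residue = routing-injective i j (residue-injective-on-cell rᵢ∈κ rⱼ∈κ′ same-residue)

  module _ (K : List Pt) (N : ℕ) (leaves : ∀ i → N ≤ i → ¬ ScaleSet Λ (_∈ K) (routing i)) where

    origin∈S∖K : ∀ i → N ≤ i → (S ∖ K) (origin i)
    origin∈S∖K i N≤i = origin∈S i , λ origin∈K → leaves i N≤i (origin i , origin∈K , routing∈cell i)

    path-from-origin : ∀ n → Path (S ∖ K) (origin N) (origin (n ℕ.+ N))
    path-from-origin zero    = here (origin∈S∖K N ℕₚ.≤-refl)
    path-from-origin (suc n) =
      path-extend (path-from-origin n) (origin∈S∖K (suc n ℕ.+ N) (ℕₚ.m≤n+m N (suc n))) (origin-near (n ℕ.+ N))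

    late-origin-reachable : ∀ i → N ≤ i → Path (S ∖ K) (origin N) (origin i)
    late-origin-reachable i N≤i = subst (Path (S ∖ K) (origin N) ∘ origin) (ℕₚ.m∸n+n≡m N≤i) (path-from-origin (i ∸ N))

    -- The centre of s is visited at some step i; if i < N then s is unscale (routing i),
    -- otherwise s is near origin i, hence reachable from origin N.
    component-finite : ∀ a → ¬ Path (S ∖ K) a (origin N) → FiniteSet (Component (S ∖ K) a)
    component-finite a unreachable = map (unscale ∘ routing) (upTo N) , covered
      where
      covered : ∀ s → Path (S ∖ K) a s → s ∈ map (unscale ∘ routing) (upTo N)
      covered s a→s with ScaleSet⇒routing (centre∈ScaleSet (proj₁ (path-end a→s)))
      ... | i , rᵢ≡centre with i <? N
      ... | yes i<N = subst (_∈ _) (trans (cong unscale rᵢ≡centre) (unscale-centre s))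
                        (∈-map⁺ (unscale ∘ routing) (∈-upTo⁺ i<N))
      ... | no  i≮N = ⊥-elim (unreachable (path-trans a→s (path-sym origin→s)))
        where
        origin-near-s : Near (origin i) s
        origin-near-s = cells-meet⇒near (routing∈cell i) (subst (Cell Λ s) (sym rᵢ≡centre) (centre∈cell s))
        origin→s : Path (S ∖ K) (origin N) s
        origin→s = path-extend (late-origin-reachable i (ℕₚ.≮⇒≥ i≮N)) (path-end a→s) origin-near-s

  cut-impossible : ¬ HasFiniteCut S
  cut-impossible (K , _ , p , q , _ , _ , p↮q , p-infinite , q-infinite) =
    ¬¬-eventually-leaves K λ (N , leaves) →
      let finite = component-finite K N leaves
      in p-infinite (finite p λ p→o → q-infinite (finite q λ q→o → p↮q (path-trans p→o (path-sym q→o))))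

theorem1 : (S : PtSet) → Connected S → Infinite S → HasFiniteCut S →
           (Λ : ScalingScheme) → (O : OS) → ¬ Foldable O (ScaleSet Λ S)
theorem1 S _ infinite _ Λ O (inj₁ halting) =
  infinite (Scaling.ScaleSet-finite⇒finite Λ (halting-fold-finite {O} halting))
theorem1 S _ _ cut Λ O (inj₂ (c , _ , steps , shape)) =
  InfiniteFold.cut-impossible {Λ = Λ} steps shape cut
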